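{- Let $x\in D$. If $0,i,-i,j\in C_x$ with $i,j\notin\{0,\frac{q^2+1}{2}\}$, then $-j\in C_x$.
   Context: $q$ is an odd prime power, $\alpha$ a primitive element of $\mathbb{F}_{q^4}$, $\mathrm{Tr}(a)=a+a^q+a^{q^2}+a^{q^3}$. Let $n=(q^2+1)(q+1)$, $D=\{i\in\mathbb{Z}_n:\mathrm{Tr}(\alpha^i)=0\}$. For $x\in D$, $C_x=\{i\in\mathbb{Z}_{q^2+1}:\mathrm{Tr}(\alpha^{x+(q+1)i})=0\}$, i.e. the $i\in\{0,\dots,q^2\}$ with $x+(q+1)i\in D$; arithmetic on elements of $C_x$ (such as $-i$) is modulo $q^2+1$. -}

module Defs where

open import Level using (Level; _⊔_) renaming (suc to lsuc)
open import Data.Nat using (ℕ; zero; suc; _∸_; _^_; _<_; _%_; _/_)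
open import Data.Nat as ℕ using ()
open import Data.Nat.Primality using (Prime)
open import Data.Nat.Divisibility using (_∣_)
open import Data.Fin using (Fin)
open import Data.Product using (∃; _×_)
open import Relation.Nullary using (¬_)
open import Relation.Binary.PropositionalEquality using (_≡_)
import Relation.Binary.PropositionalEquality as P
open import Algebra.Bundles using (CommutativeRing)
open import Function.Bundles using (Inverse)

IsOddPrimePower : ℕ → Set
IsOddPrimePower q = (∃ λ p → ∃ λ k → Prime p × 0 < k × q ≡ p ^ k) × ¬ (2 ∣ q)

record FiniteField (c ℓ : Level) (N : ℕ) : Set (lsuc (c ⊔ ℓ)) where
  field
    commRing : CommutativeRing c ℓ
  open CommutativeRing commRing public
  field
    0≉1  : ¬ (0# ≈ 1#)
    inv  : ∀ x → ¬ (x ≈ 0#) → ∃ λ y → (x * y) ≈ 1#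
    card : Inverse setoid (P.setoid (Fin N))

module _ {c ℓ : Level} {N : ℕ} (F : FiniteField c ℓ N) where
  open FiniteField F

  pow : Carrier → ℕ → Carrier
  pow x zero    = 1#
  pow x (suc m) = x * pow x m

  IsPrimitive : Carrier → Set ℓ
  IsPrimitive α = (pow α (N ∸ 1) ≈ 1#) × (∀ m → 0 < m → m < N ∸ 1 → ¬ (pow α m ≈ 1#))

  Tr : ℕ → Carrier → Carrier
  Tr q a = ((a + pow a q) + pow a (q ^ 2)) + pow a (q ^ 3)

  InD : ℕ → Carrier → ℕ → Set ℓ
  InD q α x = (x < (q ^ 2 ℕ.+ 1) ℕ.* (q ℕ.+ 1)) × (Tr q (pow α x) ≈ 0#)

  InC : ℕ → Carrier → ℕ → ℕ → Set ℓ
  InC q α x i = (i < q ^ 2 ℕ.+ 1) × (Tr q (pow α (x ℕ.+ (q ℕ.+ 1) ℕ.* i)) ≈ 0#)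

negMod : ℕ → ℕ → ℕ
negMod q i = (suc (q ^ 2) ∸ i) % suc (q ^ 2)

half : ℕ → ℕ
half q = (q ^ 2 ℕ.+ 1) / 2

{-# OPTIONS --safe #-}
-- Write y = α^x, ζ = α^(q+1), φ a = a^q and σ = φ², so that j ∈ C_x means Tr(y ζ^j) = 0.
-- As q is a power of the odd characteristic, φ is a ring endomorphism, and σ(ζ^j) is ζ^(-j)
-- times a nonzero element of F_q; hence -j ∈ C_x iff Tr(y σ(ζ^j)) = 0.
-- Put s = y + σ y and, for i, -i ∈ C_x, u = ζ^i and w = u + σ u. From σ s = s and Tr s = 0
-- follows φ s = -s, so 0 = Tr(y u) + Tr(y σ u) = Tr(s u) = s (w - φ w). If s ≠ 0 then w, and
-- also u σ u, lie in F_q, so the discriminant (u - σ u)² of the quadratic with roots u, σ u is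
-- fixed by φ; this forces σ u = u, i.e. (q²+1) ∣ (q+1) i, i.e. i = (q²+1)/2. Hence for
-- i ∉ {0, (q²+1)/2} we get s = 0, i.e. σ y = -y, and then for every j ∈ C_x
-- Tr(y σ(ζ^j)) = -Tr(σ(y ζ^j)) = -Tr(y ζ^j) = 0.
module Submission where

open import Defs
open import Level using (Level)
open import Algebra.Bundles using (CommutativeRing)
import Data.Nat as ℕ
open import Data.Nat using (ℕ; zero; suc; NonZero)
import Data.Nat.Properties as ℕ
open import Data.Nat.Divisibility using (_∣_; divides)
open import Data.Nat.Primality using (Prime)
open import Data.Product using (_,_; proj₁; proj₂; ∃-syntax)
open import Data.Sum using (_⊎_; inj₁; inj₂)
open import Relation.Nullary using (¬_; yes; no; contradiction)
import Relation.Binary.PropositionalEquality as ≡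
open import Relation.Binary.PropositionalEquality using (_≡_)

module IntegerCoefficientRingSolver {c ℓ : Level} (R : CommutativeRing c ℓ) where
  open CommutativeRing R hiding (zero)
  open import Data.Integer as ℤ using (ℤ; +_; -[1+_]; _⊖_; _◃_)
  import Data.Integer.Properties as ℤ
  import Data.Sign as Sign
  open import Data.Maybe using (Maybe; just; nothing)
  open import Algebra.Properties.Ring ring using (-0#≈0#; -‿distribˡ-*; -‿distribʳ-*; -‿involutive; -‿+-comm)
  open import Algebra.Properties.Semiring.Mult semiring using (_×_; ×-homo-+; ×1-homo-*)
  open import Algebra.Properties.CommutativeSemigroup +-commutativeSemigroup using (interchange)
  open import Algebra.Solver.Ring.AlmostCommutativeRing using (fromCommutativeRing; _-Raw-AlmostCommutative⟶_)
  open import Relation.Binary.Reasoning.Setoid setoid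

  fromℤ : ℤ → Carrier
  fromℤ (+ n)    = n × 1#
  fromℤ -[1+ n ] = - (suc n × 1#)

  private
    ⊖-homo : ∀ m n → fromℤ (m ⊖ n) ≈ m × 1# - n × 1#
    ⊖-homo m       zero    rewrite ℤ.⊖-≥ {m} {zero} ℕ.z≤n = sym (trans (+-congˡ -0#≈0#) (+-identityʳ _))
    ⊖-homo zero    (suc n) = sym (+-identityˡ _)
    ⊖-homo (suc m) (suc n) rewrite ℤ.[1+m]⊖[1+n]≡m⊖n m n = begin
      fromℤ (m ⊖ n)                      ≈⟨ ⊖-homo m n ⟩
      m × 1# - n × 1#                    ≈⟨ +-identityˡ _ ⟨
      0# + (m × 1# - n × 1#)             ≈⟨ +-congʳ (-‿inverseʳ 1#) ⟨
      (1# - 1#) + (m × 1# - n × 1#)      ≈⟨ interchange 1# (- 1#) (m × 1#) (- (n × 1#)) ⟩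
      (1# + m × 1#) + (- 1# - n × 1#)    ≈⟨ +-congˡ (-‿+-comm 1# (n × 1#)) ⟩
      (1# + m × 1#) - (1# + n × 1#)      ∎

    +-homo : ∀ i j → fromℤ (i ℤ.+ j) ≈ fromℤ i + fromℤ j
    +-homo (+ m)    (+ n)    = ×-homo-+ 1# m n
    +-homo (+ m)    -[1+ n ] = ⊖-homo m (suc n)
    +-homo -[1+ m ] (+ n)    = trans (⊖-homo n (suc m)) (+-comm _ _)
    +-homo -[1+ m ] -[1+ n ] = begin
      - (suc (suc (m ℕ.+ n)) × 1#)      ≡⟨ ≡.cong (λ k → - (suc k × 1#)) (ℕ.+-suc m n) ⟨
      - ((suc m ℕ.+ suc n) × 1#)        ≈⟨ -‿cong (×-homo-+ 1# (suc m) (suc n)) ⟩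
      - (suc m × 1# + suc n × 1#)       ≈⟨ -‿+-comm _ _ ⟨
      - (suc m × 1#) - (suc n × 1#)     ∎

    +◃-homo : ∀ n → fromℤ (Sign.+ ◃ n) ≈ n × 1#
    +◃-homo zero    = refl
    +◃-homo (suc n) = refl

    -◃-homo : ∀ n → fromℤ (Sign.- ◃ n) ≈ - (n × 1#)
    -◃-homo zero    = sym -0#≈0#
    -◃-homo (suc n) = refl

    *-homo : ∀ i j → fromℤ (i ℤ.* j) ≈ fromℤ i * fromℤ j
    *-homo (+ m)    (+ n)    = trans (+◃-homo (m ℕ.* n)) (×1-homo-* m n)
    *-homo (+ m)    -[1+ n ] =
      trans (-◃-homo (m ℕ.* suc n)) (trans (-‿cong (×1-homo-* m (suc n))) (-‿distribʳ-* _ _))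
    *-homo -[1+ m ] (+ n)    =
      trans (-◃-homo (suc m ℕ.* n)) (trans (-‿cong (×1-homo-* (suc m) n)) (-‿distribˡ-* _ _))
    *-homo -[1+ m ] -[1+ n ] = begin
      fromℤ (Sign.+ ◃ (suc m ℕ.* suc n))    ≈⟨ +◃-homo (suc m ℕ.* suc n) ⟩
      (suc m ℕ.* suc n) × 1#                ≈⟨ ×1-homo-* (suc m) (suc n) ⟩
      suc m × 1# * suc n × 1#               ≈⟨ -‿involutive _ ⟨
      - - (suc m × 1# * suc n × 1#)         ≈⟨ -‿cong (-‿distribˡ-* _ _) ⟩
      - (- (suc m × 1#) * suc n × 1#)       ≈⟨ -‿distribʳ-* _ _ ⟩
      - (suc m × 1#) * - (suc n × 1#)       ∎

    -‿homo : ∀ i → fromℤ (ℤ.- i) ≈ - fromℤ i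
    -‿homo (+ zero)  = sym -0#≈0#
    -‿homo (+ suc n) = refl
    -‿homo -[1+ n ]  = sym (-‿involutive _)

  fromℤ-homomorphism : ℤ.+-*-rawRing -Raw-AlmostCommutative⟶ fromCommutativeRing R
  fromℤ-homomorphism = record
    { ⟦_⟧ = fromℤ ; +-homo = +-homo ; *-homo = *-homo ; -‿homo = -‿homo
    ; 0-homo = refl ; 1-homo = +-identityʳ 1# }

  fromℤ-≟ : ∀ i j → Maybe (fromℤ i ≈ fromℤ j)
  fromℤ-≟ i j with i ℤ.≟ j
  ... | yes ≡.refl = just refl
  ... | no _       = nothing

  open import Algebra.Solver.Ring ℤ.+-*-rawRing (fromCommutativeRing R) fromℤ-homomorphism fromℤ-≟ public

module Arithmetic where
  open import Data.Nat
    using (_+_; _*_; _∸_; _^_; _<_; _≤_; _!; z≤n; s≤s; z<s; s<s⁻¹; nonTrivial⇒n>1)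
  open import Data.Nat.Properties
    using (<-irrefl; ≤-<-trans; <-≤-trans; *-monoˡ-≤; <-trans; n<1+n; <⇒≤; ∸-monoʳ-<; m∸n≤m; m∸n+n≡m; m+n∸n≡m;
           m<n⇒0<n∸m; +-comm; *-comm; _!*_!≢0; ^-monoʳ-<; ^-distribˡ-+-*)
  open import Data.Nat.Combinatorics using (_C_; k![n∸k]!∣n!)
  open import Data.Nat.Combinatorics.Specification using (nCk≡n!/k![n-k]!)
  open import Data.Nat.DivMod using (_/_; _%_; m/n*n≡m; m*n/n≡m; m≡m%n+[m/n]*n; m%n<n; m<n⇒m%n≡m)
  open import Data.Nat.Divisibility
    using (∣⇒≤; ∣1⇒≡1; m∣m*n; n∣m*n; ∣-trans; ∣m+n∣m⇒∣n; *-cancelˡ-∣; *-cancelʳ-∣)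
  open import Data.Nat.Coprimality using (Coprime; coprime-divisor)
  open import Data.Nat.Primality using (euclidsLemma; prime⇒nonTrivial; prime⇒nonZero)
  open import Data.Nat.Solver using (module +-*-Solver)
  open +-*-Solver using (solve; _:+_; _:*_; _:^_; _:=_; con)
  open ≡ using (refl; sym; trans; cong; subst; subst₂)

  prime>1 : ∀ {p} → Prime p → 1 < p
  prime>1 {p} p-prime = nonTrivial⇒n>1 p {{prime⇒nonTrivial p-prime}}

  n∣n! : ∀ {n} .{{_ : NonZero n}} → n ∣ n !
  n∣n! {suc n} = m∣m*n (n !)

  prime∤! : ∀ {p m} → Prime p → m < p → ¬ p ∣ m !
  prime∤! {m = zero}  p-prime _   p∣1  = <-irrefl (sym (∣1⇒≡1 p∣1)) (prime>1 p-prime)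
  prime∤! {m = suc m} p-prime m<p p∣m! with euclidsLemma (suc m) (m !) p-prime p∣m!
  ... | inj₁ p∣1+m = <-irrefl refl (≤-<-trans (∣⇒≤ p∣1+m) m<p)
  ... | inj₂ p∣m!  = prime∤! p-prime (<-trans (n<1+n m) m<p) p∣m!

  prime∣C : ∀ {p k} → Prime p → 0 < k → k < p → p ∣ p C k
  prime∣C {p} {k} p-prime 0<k k<p with euclidsLemma (p C k) (k ! * (p ∸ k) !) p-prime p∣C*k!*[p∸k]!
    where
    instance _ = k !* (p ∸ k) !≢0
    instance _ = prime⇒nonZero p-prime
    p∣C*k!*[p∸k]! : p ∣ (p C k) * (k ! * (p ∸ k) !)
    p∣C*k!*[p∸k]! = subst (p ∣_) (sym (trans (cong (_* (k ! * (p ∸ k) !)) (nCk≡n!/k![n-k]! (<⇒≤ k<p)))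
                                             (m/n*n≡m (k![n∸k]!∣n! (<⇒≤ k<p)))))
                              n∣n!
  ... | inj₁ p∣C = p∣C
  ... | inj₂ p∣k!*[p∸k]! with euclidsLemma (k !) ((p ∸ k) !) p-prime p∣k!*[p∸k]!
  ...   | inj₁ p∣k!     = contradiction p∣k! (prime∤! p-prime k<p)
  ...   | inj₂ p∣[p∸k]! = contradiction p∣[p∸k]! (prime∤! p-prime (∸-monoʳ-< 0<k (<⇒≤ k<p)))

  ¬2∣⇒odd : ∀ {n} → ¬ 2 ∣ n → ∃[ m ] n ≡ suc (2 * m)
  ¬2∣⇒odd {n} 2∤n = split (n % 2) (n / 2) (m≡m%n+[m/n]*n n 2) (m%n<n n 2)
    where
    split : ∀ r m → n ≡ r + m * 2 → r < 2 → ∃[ m ] n ≡ suc (2 * m)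
    split 0 m n≡2m _ = contradiction (divides m n≡2m) 2∤n
    split 1 m n≡1+2m _ = m , trans n≡1+2m (cong suc (*-comm m 2))
    split (suc (suc r)) _ _ (s≤s (s≤s ()))

  oddPrimePower⇒1< : ∀ {q} → IsOddPrimePower q → 1 < q
  oddPrimePower⇒1< ((p , k , p-prime , 0<k , ≡.refl) , _) = ^-monoʳ-< p (prime>1 p-prime) 0<k

  ∣⇒∣^ : ∀ {d m k} → d ∣ m → 0 < k → d ∣ m ^ k
  ∣⇒∣^ {m = m} {k = suc k} d∣m _ = ∣-trans d∣m (m∣m*n (m ^ k))

  ∣∧<2*⇒≡ : ∀ {d i} → d ∣ i → 0 < i → i < 2 * d → i ≡ d
  ∣∧<2*⇒≡     (divides 0 refl) ()
  ∣∧<2*⇒≡ {d} (divides 1 refl) _ _ = ℕ.+-identityʳ d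
  ∣∧<2*⇒≡ {d} (divides (suc (suc t)) refl) _ i<2d =
    contradiction (<-≤-trans i<2d (*-monoˡ-≤ d {2} {suc (suc t)} (s≤s (s≤s z≤n)))) (<-irrefl refl)

  q²+1∣[q+1]i⇒i≡half : ∀ {q i} → ¬ 2 ∣ q → q ^ 2 + 1 ∣ (q + 1) * i → 0 < i → i < q ^ 2 + 1 → i ≡ half q
  q²+1∣[q+1]i⇒i≡half {i = i} 2∤q q²+1∣[q+1]i 0<i i<q²+1 with ¬2∣⇒odd 2∤q
  ... | c , refl = trans (∣∧<2*⇒≡ h∣i 0<i (subst (i <_) q²+1≡2h i<q²+1)) (sym half≡h)
    where
    h : ℕ
    h = 2 * c * suc c + 1
    q²+1≡2h : suc (2 * c) ^ 2 + 1 ≡ 2 * h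
    q²+1≡2h = solve 1 (λ c → (con 1 :+ con 2 :* c) :^ 2 :+ con 1 := con 2 :* (con 2 :* c :* (con 1 :+ c) :+ con 1)) refl c
    [q+1]i≡2[c+1]i : (suc (2 * c) + 1) * i ≡ 2 * (suc c * i)
    [q+1]i≡2[c+1]i = solve 2 (λ c i → (con 1 :+ con 2 :* c :+ con 1) :* i := con 2 :* ((con 1 :+ c) :* i)) refl c i
    h-coprime : Coprime h (suc c)
    h-coprime (d∣h , d∣1+c) = ∣1⇒≡1 (∣m+n∣m⇒∣n d∣h (∣-trans d∣1+c (n∣m*n (2 * c))))
    h∣i : h ∣ i
    h∣i = coprime-divisor h-coprime (*-cancelˡ-∣ 2 (subst₂ _∣_ q²+1≡2h [q+1]i≡2[c+1]i q²+1∣[q+1]i))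
    half≡h : half (suc (2 * c)) ≡ h
    half≡h = trans (cong (_/ 2) (trans q²+1≡2h (*-comm 2 h))) (m*n/n≡m h 2)

  negMod-suc : ∀ q k → negMod q (suc k) ≡ q ^ 2 ∸ k
  negMod-suc q k = m<n⇒m%n≡m (s≤s (m∸n≤m (q ^ 2) k))

  negMod< : ∀ q j → negMod q j < q ^ 2 + 1
  negMod< q j = subst (negMod q j <_) (+-comm 1 (q ^ 2)) (m%n<n (suc (q ^ 2) ∸ j) (suc (q ^ 2)))

  1+m<n+1⇒m<n : ∀ {m n} → suc m < n + 1 → m < n
  1+m<n+1⇒m<n {m} {n} 1+m<n+1 = s<s⁻¹ (subst (suc m <_) (+-comm n 1) 1+m<n+1)

  1+[q+1][1+q²]q≡[q+1][1+q²]+q⁴ : ∀ q → suc ((q + 1) * suc (q ^ 2) * q) ≡ (q + 1) * suc (q ^ 2) + q ^ 4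
  1+[q+1][1+q²]q≡[q+1][1+q²]+q⁴ = solve 1 (λ q → con 1 :+ (q :+ con 1) :* (con 1 :+ q :^ 2) :* q := (q :+ con 1) :* (con 1 :+ q :^ 2) :+ q :^ 4) refl

  [1+k]Q≡[Q∸k]+[1+Q]k : ∀ {k Q} → k ≤ Q → suc k * Q ≡ (Q ∸ k) + suc Q * k
  [1+k]Q≡[Q∸k]+[1+Q]k {k} {Q} k≤Q = subst (λ Q → suc k * Q ≡ (Q ∸ k) + suc Q * k) (m∸n+n≡m k≤Q) (expand (Q ∸ k))
    where
    expand : ∀ k′ → suc k * (k′ + k) ≡ ((k′ + k) ∸ k) + suc (k′ + k) * k
    expand k′ = trans (solve 2 (λ k k′ → (con 1 :+ k) :* (k′ :+ k) := k′ :+ (con 1 :+ (k′ :+ k)) :* k) refl k k′)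
                      (cong (_+ suc (k′ + k) * k) (sym (m+n∸n≡m k′ k)))

  [q⁴∸1]∣e[q²∸1]⇒[q²+1]∣e : ∀ {q e} → 1 < q → q ^ 4 ∸ 1 ∣ e * (q ^ 2 ∸ 1) → q ^ 2 + 1 ∣ e
  [q⁴∸1]∣e[q²∸1]⇒[q²+1]∣e {q} {e} 1<q q⁴∸1∣e[q²∸1] = *-cancelʳ-∣ (q ^ 2 ∸ 1) {{q²∸1≢0}} (subst (_∣ e * (q ^ 2 ∸ 1)) q⁴∸1≡[q²+1][q²∸1] q⁴∸1∣e[q²∸1])
    where
    q²∸1≢0 : NonZero (q ^ 2 ∸ 1)
    q²∸1≢0 = ℕ.>-nonZero (m<n⇒0<n∸m (^-monoʳ-< q 1<q {0} {2} z<s))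
    Q²∸1≡[Q+1][Q∸1] : ∀ Q → Q * Q ∸ 1 ≡ (Q + 1) * (Q ∸ 1)
    Q²∸1≡[Q+1][Q∸1] zero    = refl
    Q²∸1≡[Q+1][Q∸1] (suc K) = solve 1 (λ K → K :+ K :* (con 1 :+ K) := (con 1 :+ K :+ con 1) :* K) refl K
    q⁴∸1≡[q²+1][q²∸1] : q ^ 4 ∸ 1 ≡ (q ^ 2 + 1) * (q ^ 2 ∸ 1)
    q⁴∸1≡[q²+1][q²∸1] = trans (cong (_∸ 1) (^-distribˡ-+-* q 2 2)) (Q²∸1≡[Q+1][Q∸1] (q ^ 2))

module FrobeniusAdditivity {c ℓ : Level} (R : CommutativeRing c ℓ) where
  open CommutativeRing R hiding (zero)
  open import Algebra.Properties.Semiring.Exp semiring using (_^_; ^-assocʳ; ^-congˡ)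
  open import Algebra.Properties.Semiring.Mult semiring using (_×_; ×-congʳ; ×-assoc-*; ×1-homo-*)
  open import Algebra.Properties.CommutativeMonoid.Sum +-commutativeMonoid
    using (sum; sum-cong-≋; sum-replicate-zero; sum-init-last)
  import Algebra.Properties.CommutativeSemiring.Binomial commutativeSemiring as Binomial
  open import Data.Nat.Combinatorics using (_C_; nCn≡1)
  open import Data.Fin as Fin using (Fin; toℕ)
  import Data.Fin.Properties as Fin
  open import Data.Vec.Functional using (init; last; tail)
  open import Relation.Binary.Reasoning.Setoid setoid
  open Arithmetic using (prime>1; prime∣C)

  char∣⇒×≈0 : ∀ {p n} → p × 1# ≈ 0# → p ∣ n → ∀ x → n × x ≈ 0#
  char∣⇒×≈0 {p} p×1≈0 (divides m ≡.refl) x = begin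
    (m ℕ.* p) × x                 ≈⟨ ×-congʳ (m ℕ.* p) (*-identityˡ x) ⟨
    (m ℕ.* p) × (1# * x)          ≈⟨ ×-assoc-* (m ℕ.* p) 1# x ⟨
    (m ℕ.* p) × 1# * x            ≈⟨ *-congʳ (×1-homo-* m p) ⟩
    (m × 1#) * (p × 1#) * x       ≈⟨ *-congʳ (*-congˡ p×1≈0) ⟩
    (m × 1#) * 0# * x             ≈⟨ *-congʳ (zeroʳ _) ⟩
    0# * x                        ≈⟨ zeroˡ x ⟩
    0#                            ∎

  ^-prime-+ : ∀ {p} → Prime p → p × 1# ≈ 0# → ∀ x y → (x + y) ^ p ≈ x ^ p + y ^ p
  ^-prime-+ {zero}        p-prime _ = contradiction (prime>1 p-prime) λ ()
  ^-prime-+ {suc zero}    p-prime _ = contradiction (prime>1 p-prime) λ { (ℕ.s≤s ()) }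
  ^-prime-+ {suc (suc n)} p-prime p×1≈0 x y = begin
    (x + y) ^ p                                       ≈⟨ Binomial.theorem p x y ⟩
    term Fin.zero + sum (tail term)                   ≈⟨ +-congˡ (sum-init-last (tail term)) ⟩
    term Fin.zero + (sum (init (tail term)) + last (tail term))
      ≈⟨ +-congˡ (+-congʳ (trans (sum-cong-≋ inner-term≈0) (sum-replicate-zero (suc n)))) ⟩
    term Fin.zero + (0# + last (tail term))           ≈⟨ +-cong first-term (trans (+-identityˡ _) last-term) ⟩
    y ^ p + x ^ p                                     ≈⟨ +-comm _ _ ⟩
    x ^ p + y ^ p                                     ∎
    where
    p : ℕ
    p = suc (suc n)
    term : Fin (suc p) → Carrier
    term = Binomial.binomialTerm x y p
    first-term : term Fin.zero ≈ y ^ p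
    first-term = trans (+-identityʳ _) (*-identityˡ _)
    top-term : ∀ k → k ≡ p → (p C k) × (x ^ k * y ^ (p ℕ.∸ k)) ≈ x ^ p
    top-term k ≡.refl rewrite nCn≡1 p | ℕ.n∸n≡0 p = trans (+-identityʳ _) (*-identityʳ _)
    last-term : last (tail term) ≈ x ^ p
    last-term = top-term (toℕ (Fin.fromℕ p)) (Fin.toℕ-fromℕ p)
    inner-term≈0 : ∀ i → term (Fin.suc (Fin.inject₁ i)) ≈ 0#
    inner-term≈0 i = char∣⇒×≈0 p×1≈0 (prime∣C p-prime (ℕ.s≤s ℕ.z≤n) k<p) _
      where
      k<p : suc (toℕ (Fin.inject₁ i)) ℕ.< p
      k<p = ℕ.s≤s (≡.subst (ℕ._< suc n) (≡.sym (Fin.toℕ-inject₁ i)) (Fin.toℕ<n i))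

  ^-prime-power-+ : ∀ {p} → Prime p → p × 1# ≈ 0# → ∀ e x y → (x + y) ^ (p ℕ.^ e) ≈ x ^ (p ℕ.^ e) + y ^ (p ℕ.^ e)
  ^-prime-power-+ p-prime p×1≈0 zero    x y = trans (*-identityʳ _) (sym (+-cong (*-identityʳ x) (*-identityʳ y)))
  ^-prime-power-+ {p} p-prime p×1≈0 (suc e) x y = begin
    (x + y) ^ (p ℕ.* p ℕ.^ e)              ≈⟨ ^-assocʳ (x + y) p (p ℕ.^ e) ⟨
    ((x + y) ^ p) ^ (p ℕ.^ e)              ≈⟨ ^-congˡ (p ℕ.^ e) (^-prime-+ p-prime p×1≈0 x y) ⟩
    (x ^ p + y ^ p) ^ (p ℕ.^ e)            ≈⟨ ^-prime-power-+ p-prime p×1≈0 e (x ^ p) (y ^ p) ⟩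
    (x ^ p) ^ (p ℕ.^ e) + (y ^ p) ^ (p ℕ.^ e)   ≈⟨ +-cong (^-assocʳ x p (p ℕ.^ e)) (^-assocʳ y p (p ℕ.^ e)) ⟩
    x ^ (p ℕ.* p ℕ.^ e) + y ^ (p ℕ.* p ℕ.^ e)   ∎

module FieldProperties {c ℓ N} (F : FiniteField c ℓ N) where
  open FiniteField F hiding (zero)
  open import Algebra.Properties.Ring ring
    using (+-cancelˡ; +-inverseˡ-unique; x∙y⁻¹≈ε⇒x≈y; x≈y⇒x∙y⁻¹≈ε; x[y-z]≈xy-xz)
  open import Algebra.Properties.CommutativeSemiring.Exp commutativeSemiring using (_^_; ^-homo-*; ^-assocʳ; ^-congˡ)
  open import Algebra.Properties.Semiring.Mult semiring using (_×_; ×1-homo-*)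
  open import Algebra.Properties.CommutativeMonoid.Sum +-commutativeMonoid
    using (sum; sum-permute; sum-cong-≋; ∑-distrib-+; sum-replicate)
  open import Data.Fin as Fin using (Fin)
  open import Data.Fin.Permutation using (Permutation; permutation)
  open import Data.Nat.DivMod using (_/_; _%_; m≡m%n+[m/n]*n; m%n<n)
  open import Function.Bundles using (Inverse)
  open import Function.Properties.Inverse using (Inverse⇒Injection)
  open import Relation.Nullary.Decidable using (via-injection)
  open import Relation.Binary.Definitions using (Decidable)
  open import Relation.Binary.Reasoning.Setoid setoid
  open IntegerCoefficientRingSolver commRing using (solve; _:+_; _:-_; _:*_; _:=_)
  open Arithmetic using (¬2∣⇒odd)

  infix 4 _≟_
  _≟_ : Decidable _≈_
  _≟_ = via-injection (Inverse⇒Injection card) Fin._≟_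

  x*y≈0⇒x≈0⊎y≈0 : ∀ {x y} → x * y ≈ 0# → x ≈ 0# ⊎ y ≈ 0#
  x*y≈0⇒x≈0⊎y≈0 {x} {y} xy≈0 with x ≟ 0#
  ... | yes x≈0 = inj₁ x≈0
  ... | no  x≉0 with inv x x≉0
  ...   | x⁻¹ , xx⁻¹≈1 = inj₂ (begin
    y                ≈⟨ *-identityˡ y ⟨
    1# * y           ≈⟨ *-congʳ xx⁻¹≈1 ⟨
    x * x⁻¹ * y      ≈⟨ *-congʳ (*-comm x x⁻¹) ⟩
    x⁻¹ * x * y      ≈⟨ *-assoc x⁻¹ x y ⟩
    x⁻¹ * (x * y)    ≈⟨ *-congˡ xy≈0 ⟩
    x⁻¹ * 0#         ≈⟨ zeroʳ x⁻¹ ⟩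
    0#               ∎)

  *-cancelˡ-≉0 : ∀ {x y z} → ¬ x ≈ 0# → x * y ≈ x * z → y ≈ z
  *-cancelˡ-≉0 {x} {y} {z} x≉0 xy≈xz with x*y≈0⇒x≈0⊎y≈0 (trans (x[y-z]≈xy-xz x y z) (x≈y⇒x∙y⁻¹≈ε xy≈xz))
  ... | inj₁ x≈0   = contradiction x≈0 x≉0
  ... | inj₂ y-z≈0 = x∙y⁻¹≈ε⇒x≈y y z y-z≈0

  x^n≈0⇒x≈0 : ∀ {x} n → x ^ n ≈ 0# → x ≈ 0#
  x^n≈0⇒x≈0 zero    1≈0   = contradiction (sym 1≈0) 0≉1
  x^n≈0⇒x≈0 (suc n) xxⁿ≈0 with x*y≈0⇒x≈0⊎y≈0 xxⁿ≈0
  ... | inj₁ x≈0  = x≈0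
  ... | inj₂ xⁿ≈0 = x^n≈0⇒x≈0 n xⁿ≈0

  x≉0⇒x^n≉0 : ∀ {x} n → ¬ x ≈ 0# → ¬ x ^ n ≈ 0#
  x≉0⇒x^n≉0 n x≉0 xⁿ≈0 = x≉0 (x^n≈0⇒x≈0 n xⁿ≈0)

  x*x≈y*y⇒x≈y⊎x≈-y : ∀ {x y} → x * x ≈ y * y → x ≈ y ⊎ x ≈ - y
  x*x≈y*y⇒x≈y⊎x≈-y {x} {y} xx≈yy with x*y≈0⇒x≈0⊎y≈0 {x - y} {x + y} (begin
    (x - y) * (x + y)   ≈⟨ solve 2 (λ x y → (x :- y) :* (x :+ y) := x :* x :- y :* y) refl x y ⟩
    x * x - y * y       ≈⟨ x≈y⇒x∙y⁻¹≈ε xx≈yy ⟩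
    0#                  ∎)
  ... | inj₁ x-y≈0 = inj₁ (x∙y⁻¹≈ε⇒x≈y x y x-y≈0)
  ... | inj₂ x+y≈0 = inj₂ (+-inverseˡ-unique x y x+y≈0)

  x+x≈0⇒x≈0 : ¬ 1# + 1# ≈ 0# → ∀ {x} → x + x ≈ 0# → x ≈ 0#
  x+x≈0⇒x≈0 2≉0 {x} x+x≈0 with x*y≈0⇒x≈0⊎y≈0 {1# + 1#} {x} (begin
    (1# + 1#) * x    ≈⟨ distribʳ x 1# 1# ⟩
    1# * x + 1# * x  ≈⟨ +-cong (*-identityˡ x) (*-identityˡ x) ⟩
    x + x            ≈⟨ x+x≈0 ⟩
    0#               ∎)
  ... | inj₁ 2≈0 = contradiction 2≈0 2≉0
  ... | inj₂ x≈0 = x≈0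

  pow≡^ : ∀ x n → pow F x n ≡ x ^ n
  pow≡^ x zero    = ≡.refl
  pow≡^ x (suc n) = ≡.cong (x *_) (pow≡^ x n)

  1^n≈1 : ∀ n → 1# ^ n ≈ 1#
  1^n≈1 zero    = refl
  1^n≈1 (suc n) = trans (*-identityˡ _) (1^n≈1 n)

  ^-comm : ∀ x m n → (x ^ m) ^ n ≈ (x ^ n) ^ m
  ^-comm x m n = begin
    (x ^ m) ^ n     ≈⟨ ^-assocʳ x m n ⟩
    x ^ (m ℕ.* n)   ≡⟨ ≡.cong (x ^_) (ℕ.*-comm m n) ⟩
    x ^ (n ℕ.* m)   ≈⟨ ^-assocʳ x n m ⟨
    (x ^ n) ^ m     ∎

  -- Translation by 1 permutes the N elements, so Σ a = Σ (a + 1) = Σ a + N·1.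
  card×1≈0 : N × 1# ≈ 0#
  card×1≈0 = +-cancelˡ Σ (N × 1#) 0# (begin
    Σ + N × 1#                 ≈⟨ +-congˡ (sum-replicate N) ⟨
    Σ + sum {N} (λ _ → 1#)     ≈⟨ ∑-distrib-+ from (λ _ → 1#) ⟨
    sum (λ k → from k + 1#)    ≈⟨ sum-cong-≋ (λ k → strictlyInverseʳ (from k + 1#)) ⟨
    sum (λ k → from (shift k)) ≈⟨ sum-permute from shift-permutation ⟨
    Σ                          ≈⟨ +-identityʳ Σ ⟨
    Σ + 0#                     ∎)
    where
    open Inverse card using (to; from; to-cong; strictlyInverseˡ; strictlyInverseʳ)
    Σ : Carrier
    Σ = sum from
    shift unshift : Fin N → Fin N
    shift   k = to (from k + 1#)
    unshift k = to (from k - 1#)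
    shift-permutation : Permutation N N
    shift-permutation = permutation shift unshift
      (λ k → ≡.trans (to-cong (begin
        from (unshift k) + 1#  ≈⟨ +-congʳ (strictlyInverseʳ _) ⟩
        (from k - 1#) + 1#     ≈⟨ solve 2 (λ a b → (a :- b) :+ b := a) refl (from k) 1# ⟩
        from k                 ∎)) (strictlyInverseˡ k))
      (λ k → ≡.trans (to-cong (begin
        from (shift k) - 1#    ≈⟨ +-congʳ (strictlyInverseʳ _) ⟩
        (from k + 1#) - 1#     ≈⟨ solve 2 (λ a b → (a :+ b) :- b := a) refl (from k) 1# ⟩
        from k                 ∎)) (strictlyInverseˡ k))

  prime-power-card⇒char : ∀ {p e} → N ≡ p ℕ.^ e → p × 1# ≈ 0#
  prime-power-card⇒char {p} {e} N≡pᵉ = x^n≈0⇒x≈0 e (begin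
    (p × 1#) ^ e      ≈⟨ ^-×1 e ⟨
    (p ℕ.^ e) × 1#    ≡⟨ ≡.cong (_× 1#) N≡pᵉ ⟨
    N × 1#            ≈⟨ card×1≈0 ⟩
    0#                ∎)
    where
    ^-×1 : ∀ e → (p ℕ.^ e) × 1# ≈ (p × 1#) ^ e
    ^-×1 zero    = +-identityʳ 1#
    ^-×1 (suc e) = trans (×1-homo-* p (p ℕ.^ e)) (*-congˡ (^-×1 e))

  odd-char⇒1+1≉0 : ∀ {p} → ¬ 2 ∣ p → p × 1# ≈ 0# → ¬ 1# + 1# ≈ 0#
  odd-char⇒1+1≉0 2∤p p×1≈0 2≈0 with ¬2∣⇒odd 2∤p
  ... | m , ≡.refl = 0≉1 (begin
    0#                       ≈⟨ p×1≈0 ⟨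
    1# + (2 ℕ.* m) × 1#      ≈⟨ +-congˡ (×1-homo-* 2 m) ⟩
    1# + (2 × 1#) * m × 1#   ≈⟨ +-congˡ (*-congʳ (trans (+-congˡ (+-identityʳ 1#)) 2≈0)) ⟩
    1# + 0# * m × 1#         ≈⟨ +-congˡ (zeroˡ _) ⟩
    1# + 0#                  ≈⟨ +-identityʳ 1# ⟩
    1#                       ∎)

  primitive⇒order∣ : ∀ {α} → IsPrimitive F α → .{{_ : NonZero (N ℕ.∸ 1)}} → ∀ {d} → α ^ d ≈ 1# → (N ℕ.∸ 1) ∣ d
  primitive⇒order∣ {α} (αᴹ≈1 , α-order) {d} αᵈ≈1 = split (d % M) (d / M) (m≡m%n+[m/n]*n d M) (m%n<n d M)
    where
    M : ℕ
    M = N ℕ.∸ 1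
    split : ∀ r t → d ≡ r ℕ.+ t ℕ.* M → r ℕ.< M → M ∣ d
    split zero    t d≡tM _   = divides t d≡tM
    split (suc r) t d≡r+tM r<M = contradiction (≡.subst (_≈ 1#) (≡.sym (pow≡^ α (suc r))) αʳ≈1) (α-order (suc r) ℕ.z<s r<M)
      where
      αʳ≈1 : α ^ suc r ≈ 1#
      αʳ≈1 = begin
        α ^ suc r                        ≈⟨ *-identityʳ _ ⟨
        α ^ suc r * 1#                   ≈⟨ *-congˡ (1^n≈1 t) ⟨
        α ^ suc r * 1# ^ t               ≈⟨ *-congˡ (^-congˡ t (≡.subst (_≈ 1#) (pow≡^ α M) αᴹ≈1)) ⟨
        α ^ suc r * (α ^ M) ^ t          ≈⟨ *-congˡ (^-comm α M t) ⟩
        α ^ suc r * (α ^ t) ^ M          ≈⟨ *-congˡ (^-assocʳ α t M) ⟩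
        α ^ suc r * α ^ (t ℕ.* M)        ≈⟨ ^-homo-* α (suc r) (t ℕ.* M) ⟨
        α ^ (suc r ℕ.+ t ℕ.* M)          ≡⟨ ≡.cong (α ^_) d≡r+tM ⟨
        α ^ d                            ≈⟨ αᵈ≈1 ⟩
        1#                               ∎

module _ {c ℓ N} (F : FiniteField c ℓ N) where
  open FiniteField F hiding (zero)

  module Trace (φ : Carrier → Carrier) (φ-cong : ∀ {a b} → a ≈ b → φ a ≈ φ b)
               (φ-+ : ∀ a b → φ (a + b) ≈ φ a + φ b) (φ-* : ∀ a b → φ (a * b) ≈ φ a * φ b) where
    open import Algebra.Properties.Ring ring
      using (-‿involutive; -‿distribˡ-*; x+x≈x⇒x≈0; +-inverseˡ-unique; +-inverseʳ-unique;
             x∙y⁻¹≈ε⇒x≈y; x[y-z]≈xy-xz; ⁻¹-anti-homo‿-; -0#≈0#)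
    open import Algebra.Properties.CommutativeSemigroup +-commutativeSemigroup using (interchange)
    open import Relation.Binary.Reasoning.Setoid setoid
    open IntegerCoefficientRingSolver commRing using (solve; _:+_; _:-_; _:*_; _:=_)
    open FieldProperties F using (_≟_; x*y≈0⇒x≈0⊎y≈0; x*x≈y*y⇒x≈y⊎x≈-y; x+x≈0⇒x≈0)

    σ : Carrier → Carrier
    σ a = φ (φ a)

    trace : Carrier → Carrier
    trace a = ((a + φ a) + σ a) + φ (σ a)

    φ-0 : φ 0# ≈ 0#
    φ-0 = x+x≈x⇒x≈0 (φ 0#) (trans (sym (φ-+ 0# 0#)) (φ-cong (+-identityʳ 0#)))

    φ-neg : ∀ a → φ (- a) ≈ - φ a
    φ-neg a = +-inverseˡ-unique (φ (- a)) (φ a) (trans (sym (φ-+ (- a) a)) (trans (φ-cong (-‿inverseˡ a)) φ-0))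

    φ[a-b]≈φa-φb : ∀ a b → φ (a - b) ≈ φ a - φ b
    φ[a-b]≈φa-φb a b = trans (φ-+ a (- b)) (+-congˡ (φ-neg b))

    σ-cong : ∀ {a b} → a ≈ b → σ a ≈ σ b
    σ-cong a≈b = φ-cong (φ-cong a≈b)

    σ-+ : ∀ a b → σ (a + b) ≈ σ a + σ b
    σ-+ a b = trans (φ-cong (φ-+ a b)) (φ-+ (φ a) (φ b))

    σ-* : ∀ a b → σ (a * b) ≈ σ a * σ b
    σ-* a b = trans (φ-cong (φ-* a b)) (φ-* (φ a) (φ b))

    σ-neg : ∀ a → σ (- a) ≈ - σ a
    σ-neg a = trans (φ-cong (φ-neg a)) (φ-neg (φ a))

    trace-cong : ∀ {a b} → a ≈ b → trace a ≈ trace b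
    trace-cong a≈b = +-cong (+-cong (+-cong a≈b (φ-cong a≈b)) (σ-cong a≈b)) (φ-cong (σ-cong a≈b))

    trace≈[a+σa]+φ[a+σa] : ∀ a → trace a ≈ (a + σ a) + φ (a + σ a)
    trace≈[a+σa]+φ[a+σa] a = begin
      ((a + φ a) + σ a) + φ (σ a)    ≈⟨ +-assoc (a + φ a) (σ a) (φ (σ a)) ⟩
      (a + φ a) + (σ a + φ (σ a))    ≈⟨ interchange a (φ a) (σ a) (φ (σ a)) ⟩
      (a + σ a) + (φ a + φ (σ a))    ≈⟨ +-congˡ (φ-+ a (σ a)) ⟨
      (a + σ a) + φ (a + σ a)        ∎

    trace-+ : ∀ a b → trace (a + b) ≈ trace a + trace b
    trace-+ a b = begin
      (((a + b) + φ (a + b)) + σ (a + b)) + φ (σ (a + b))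
        ≈⟨ +-cong (+-cong (+-congˡ (φ-+ a b)) (σ-+ a b)) (trans (φ-cong (σ-+ a b)) (φ-+ (σ a) (σ b))) ⟩
      (((a + b) + (φ a + φ b)) + (σ a + σ b)) + (φ (σ a) + φ (σ b))
        ≈⟨ +-congʳ (+-congʳ (interchange a b (φ a) (φ b))) ⟩
      (((a + φ a) + (b + φ b)) + (σ a + σ b)) + (φ (σ a) + φ (σ b))
        ≈⟨ +-congʳ (interchange (a + φ a) (b + φ b) (σ a) (σ b)) ⟩
      (((a + φ a) + σ a) + ((b + φ b) + σ b)) + (φ (σ a) + φ (σ b))
        ≈⟨ interchange ((a + φ a) + σ a) ((b + φ b) + σ b) (φ (σ a)) (φ (σ b)) ⟩
      trace a + trace b ∎

    trace-0 : trace 0# ≈ 0#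
    trace-0 = x+x≈x⇒x≈0 (trace 0#) (trans (sym (trace-+ 0# 0#)) (trace-cong (+-identityʳ 0#)))

    trace-neg : ∀ a → trace (- a) ≈ - trace a
    trace-neg a = +-inverseˡ-unique (trace (- a)) (trace a)
      (trans (sym (trace-+ (- a) a)) (trans (trace-cong (-‿inverseˡ a)) trace-0))

    trace-*-φ-fixed : ∀ {b} → φ b ≈ b → ∀ a → trace (b * a) ≈ b * trace a
    trace-*-φ-fixed {b} φb≈b a = begin
      ((b * a + φ (b * a)) + σ (b * a)) + φ (σ (b * a))
        ≈⟨ +-cong (+-cong (+-congˡ φ[ba]) σ[ba]) (trans (φ-cong σ[ba]) (φ[b*] (σ a))) ⟩
      ((b * a + b * φ a) + b * σ a) + b * φ (σ a)
        ≈⟨ +-congʳ (+-congʳ (distribˡ b a (φ a))) ⟨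
      (b * (a + φ a) + b * σ a) + b * φ (σ a)
        ≈⟨ +-congʳ (distribˡ b (a + φ a) (σ a)) ⟨
      b * ((a + φ a) + σ a) + b * φ (σ a)
        ≈⟨ distribˡ b ((a + φ a) + σ a) (φ (σ a)) ⟨
      b * trace a ∎
      where
      φ[b*] : ∀ x → φ (b * x) ≈ b * φ x
      φ[b*] x = trans (φ-* b x) (*-congʳ φb≈b)
      φ[ba] : φ (b * a) ≈ b * φ a
      φ[ba] = φ[b*] a
      σ[ba] : σ (b * a) ≈ b * σ a
      σ[ba] = trans (φ-cong φ[ba]) (φ[b*] (φ a))

    trace-σ : ∀ {a} → σ (σ a) ≈ a → trace (σ a) ≈ trace a
    trace-σ {a} σσa≈a = begin
      ((σ a + φ (σ a)) + σ (σ a)) + φ (σ (σ a))   ≈⟨ +-cong (+-congˡ σσa≈a) (φ-cong σσa≈a) ⟩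
      ((σ a + φ (σ a)) + a) + φ a                 ≈⟨ +-assoc (σ a + φ (σ a)) a (φ a) ⟩
      (σ a + φ (σ a)) + (a + φ a)                 ≈⟨ +-comm (σ a + φ (σ a)) (a + φ a) ⟩
      (a + φ a) + (σ a + φ (σ a))                 ≈⟨ +-assoc (a + φ a) (σ a) (φ (σ a)) ⟨
      trace a                                     ∎

    σ[a-b]≈σa-σb : ∀ a b → σ (a - b) ≈ σ a - σ b
    σ[a-b]≈σa-σb a b = trans (σ-+ a (- b)) (+-congˡ (σ-neg b))

    σ-fixed∧trace≈0⇒φ-negates : ¬ 1# + 1# ≈ 0# → ∀ {s} → σ s ≈ s → trace s ≈ 0# → φ s ≈ - s
    σ-fixed∧trace≈0⇒φ-negates 2≉0 {s} σs≈s trace-s≈0 = +-inverseʳ-unique s (φ s) (x+x≈0⇒x≈0 2≉0 (begin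
      (s + φ s) + (s + φ s)       ≈⟨ interchange s (φ s) s (φ s) ⟩
      (s + s) + (φ s + φ s)       ≈⟨ +-cong (+-congˡ σs≈s) (+-congˡ (φ-cong σs≈s)) ⟨
      (s + σ s) + (φ s + φ (σ s)) ≈⟨ +-congˡ (φ-+ s (σ s)) ⟨
      (s + σ s) + φ (s + σ s)     ≈⟨ trace≈[a+σa]+φ[a+σa] s ⟨
      trace s                     ≈⟨ trace-s≈0 ⟩
      0#                          ∎))

    trace-*-φ-negated : ∀ {s} → φ s ≈ - s → σ s ≈ s → ∀ u → trace (s * u) ≈ s * ((u + σ u) - φ (u + σ u))
    trace-*-φ-negated {s} φs≈-s σs≈s u = begin
      trace (s * u)                                 ≈⟨ trace≈[a+σa]+φ[a+σa] (s * u) ⟩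
      (s * u + σ (s * u)) + φ (s * u + σ (s * u))   ≈⟨ +-cong s[u+σu] (φ-cong s[u+σu]) ⟩
      s * w + φ (s * w)                             ≈⟨ +-congˡ (trans (φ-* s w) (*-congʳ φs≈-s)) ⟩
      s * w + - s * φ w                             ≈⟨ +-congˡ (-‿distribˡ-* s (φ w)) ⟨
      s * w - s * φ w                               ≈⟨ x[y-z]≈xy-xz s w (φ w) ⟨
      s * (w - φ w)                                 ∎
      where
      w : Carrier
      w = u + σ u
      s[u+σu] : s * u + σ (s * u) ≈ s * w
      s[u+σu] = trans (+-congˡ (trans (σ-* s u) (*-congʳ σs≈s))) (sym (distribˡ s u (σ u)))

    φ[x]²≈x²⇒σx≈x : ∀ {x} → φ x * φ x ≈ x * x → σ x ≈ x
    φ[x]²≈x²⇒σx≈x {x} φx²≈x² with x*x≈y*y⇒x≈y⊎x≈-y φx²≈x²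
    ... | inj₁ φx≈x  = trans (φ-cong φx≈x) φx≈x
    ... | inj₂ φx≈-x = trans (φ-cong φx≈-x) (trans (φ-neg x) (trans (-‿cong φx≈-x) (-‿involutive x)))

    φ-fixed-sum∧product⇒σ-fixed : ¬ 1# + 1# ≈ 0# → ∀ {u} → σ (σ u) ≈ u →
      φ (u + σ u) ≈ u + σ u → φ (u * σ u) ≈ u * σ u → σ u ≈ u
    φ-fixed-sum∧product⇒σ-fixed 2≉0 {u} σσu≈u φw≈w φn≈n = sym (x∙y⁻¹≈ε⇒x≈y u (σ u) r≈0)
      where
      w n r : Carrier
      w = u + σ u
      n = u * σ u
      r = u - σ u
      -- the discriminant of X² - w X + n, whose roots are u and σ u
      r²≈w²-4n : r * r ≈ w * w - (((n + n) + n) + n)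
      r²≈w²-4n = solve 2 (λ a b → (a :- b) :* (a :- b) := (a :+ b) :* (a :+ b) :- (((a :* b :+ a :* b) :+ a :* b) :+ a :* b))
                   refl u (σ u)
      φ-4n : φ (((n + n) + n) + n) ≈ ((n + n) + n) + n
      φ-4n = trans (φ-+ _ n) (+-cong (trans (φ-+ _ n) (+-cong (trans (φ-+ n n) (+-cong φn≈n φn≈n)) φn≈n)) φn≈n)
      φr²≈r² : φ r * φ r ≈ r * r
      φr²≈r² = begin
        φ r * φ r                            ≈⟨ φ-* r r ⟨
        φ (r * r)                            ≈⟨ φ-cong r²≈w²-4n ⟩
        φ (w * w - (((n + n) + n) + n))      ≈⟨ φ[a-b]≈φa-φb (w * w) _ ⟩
        φ (w * w) - φ (((n + n) + n) + n)    ≈⟨ +-cong (trans (φ-* w w) (*-cong φw≈w φw≈w)) (-‿cong φ-4n) ⟩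
        w * w - (((n + n) + n) + n)          ≈⟨ r²≈w²-4n ⟨
        r * r                                ∎
      σr≈-r : σ r ≈ - r
      σr≈-r = trans (σ[a-b]≈σa-σb u (σ u)) (trans (+-congˡ (-‿cong σσu≈u)) (sym (⁻¹-anti-homo‿- u (σ u))))
      r≈0 : r ≈ 0#
      r≈0 = x+x≈0⇒x≈0 2≉0 (trans (+-congʳ (trans (sym (φ[x]²≈x²⇒σx≈x φr²≈r²)) σr≈-r)) (-‿inverseˡ r))

    trace-σ-swap : ∀ {y u} → σ (σ y) ≈ y → σ (σ u) ≈ u → trace (σ y * u) ≈ trace (y * σ u)
    trace-σ-swap {y} {u} σσy≈y σσu≈u = begin
      trace (σ y * u)          ≈⟨ trace-cong (*-congˡ σσu≈u) ⟨
      trace (σ y * σ (σ u))    ≈⟨ trace-cong (σ-* y (σ u)) ⟨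
      trace (σ (y * σ u))      ≈⟨ trace-σ σσ[yσu]≈yσu ⟩
      trace (y * σ u)          ∎
      where
      σσ[yσu]≈yσu : σ (σ (y * σ u)) ≈ y * σ u
      σσ[yσu]≈yσu = trans (σ-cong (σ-* y (σ u))) (trans (σ-* (σ y) (σ (σ u))) (*-cong σσy≈y (σ-cong σσu≈u)))

    σ-negates⊎σ-fixes : ¬ 1# + 1# ≈ 0# → ∀ {y u} → σ (σ y) ≈ y → σ (σ u) ≈ u → φ (u * σ u) ≈ u * σ u →
      trace y ≈ 0# → trace (y * u) ≈ 0# → trace (y * σ u) ≈ 0# → σ y ≈ - y ⊎ σ u ≈ u
    σ-negates⊎σ-fixes 2≉0 {y} {u} σσy≈y σσu≈u φn≈n trace-y≈0 trace-yu≈0 trace-yσu≈0 with y + σ y ≟ 0#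
    ... | yes s≈0 = inj₁ (+-inverseʳ-unique y (σ y) s≈0)
    ... | no  s≉0 = inj₂ (φ-fixed-sum∧product⇒σ-fixed 2≉0 σσu≈u φw≈w φn≈n)
      where
      s w : Carrier
      s = y + σ y
      w = u + σ u
      σs≈s : σ s ≈ s
      σs≈s = trans (σ-+ y (σ y)) (trans (+-congˡ σσy≈y) (+-comm (σ y) y))
      trace-s≈0 : trace s ≈ 0#
      trace-s≈0 = trans (trace-+ y (σ y)) (trans (+-cong trace-y≈0 (trans (trace-σ σσy≈y) trace-y≈0)) (+-identityʳ 0#))
      trace-su≈0 : trace (s * u) ≈ 0#
      trace-su≈0 = begin
        trace (s * u)                      ≈⟨ trace-cong (distribʳ u y (σ y)) ⟩
        trace (y * u + σ y * u)            ≈⟨ trace-+ (y * u) (σ y * u) ⟩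
        trace (y * u) + trace (σ y * u)    ≈⟨ +-cong trace-yu≈0 (trans (trace-σ-swap σσy≈y σσu≈u) trace-yσu≈0) ⟩
        0# + 0#                            ≈⟨ +-identityʳ 0# ⟩
        0#                                 ∎
      φs≈-s : φ s ≈ - s
      φs≈-s = σ-fixed∧trace≈0⇒φ-negates 2≉0 σs≈s trace-s≈0
      φw≈w : φ w ≈ w
      φw≈w with x*y≈0⇒x≈0⊎y≈0 (trans (sym (trace-*-φ-negated φs≈-s σs≈s u)) trace-su≈0)
      ... | inj₁ s≈0    = contradiction s≈0 s≉0
      ... | inj₂ w-φw≈0 = sym (x∙y⁻¹≈ε⇒x≈y w (φ w) w-φw≈0)

    σ-negates⇒trace-σ≈0 : ∀ {y u} → σ y ≈ - y → σ (σ u) ≈ u → trace (y * u) ≈ 0# → trace (y * σ u) ≈ 0#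
    σ-negates⇒trace-σ≈0 {y} {u} σy≈-y σσu≈u trace-yu≈0 = begin
      trace (y * σ u)          ≈⟨ trace-cong yσu≈-σ[yu] ⟩
      trace (- σ (y * u))      ≈⟨ trace-neg (σ (y * u)) ⟩
      - trace (σ (y * u))      ≈⟨ -‿cong (trace-σ σσ[yu]≈yu) ⟩
      - trace (y * u)          ≈⟨ -‿cong trace-yu≈0 ⟩
      - 0#                     ≈⟨ -0#≈0# ⟩
      0#                       ∎
      where
      σσy≈y : σ (σ y) ≈ y
      σσy≈y = trans (σ-cong σy≈-y) (trans (σ-neg y) (trans (-‿cong σy≈-y) (-‿involutive y)))
      σσ[yu]≈yu : σ (σ (y * u)) ≈ y * u
      σσ[yu]≈yu = trans (σ-cong (σ-* y u)) (trans (σ-* (σ y) (σ u)) (*-cong σσy≈y σσu≈u))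
      yσu≈-σ[yu] : y * σ u ≈ - σ (y * u)
      yσu≈-σ[yu] = begin
        y * σ u          ≈⟨ *-congʳ (-‿involutive y) ⟨
        - - y * σ u      ≈⟨ *-congʳ (-‿cong σy≈-y) ⟨
        - σ y * σ u      ≈⟨ -‿distribˡ-* (σ y) (σ u) ⟨
        - (σ y * σ u)    ≈⟨ -‿cong (σ-* y u) ⟨
        - σ (y * u)      ∎


module _ {c ℓ} (q : ℕ) (F : FiniteField c ℓ (q ℕ.^ 4)) where
  open FiniteField F hiding (zero)
  open import Algebra.Properties.CommutativeSemiring.Exp commutativeSemiring
    using (_^_; ^-homo-*; ^-assocʳ; ^-congˡ; ^-distrib-*)
  open import Algebra.Properties.Semiring.Mult semiring using (_×_)
  open FieldProperties F
  open Arithmetic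

  q≡pᵏ⇒p×1≈0 : ∀ {p k} → q ≡ p ℕ.^ k → p × 1# ≈ 0#
  q≡pᵏ⇒p×1≈0 {p} {k} q≡pᵏ = prime-power-card⇒char {p} {k ℕ.* 4} (≡.trans (≡.cong (ℕ._^ 4) q≡pᵏ) (ℕ.^-*-assoc p k 4))

  oddPrimePower⇒^q-+ : IsOddPrimePower q → ∀ a b → (a + b) ^ q ≈ a ^ q + b ^ q
  oddPrimePower⇒^q-+ ((p , k , p-prime , _ , q≡pᵏ) , _) =
    ≡.subst (λ n → ∀ a b → (a + b) ^ n ≈ a ^ n + b ^ n) (≡.sym q≡pᵏ) (^-prime-power-+ p-prime (q≡pᵏ⇒p×1≈0 {p} {k} q≡pᵏ) k)
    where open FrobeniusAdditivity commRing using (^-prime-power-+)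

  oddPrimePower⇒1+1≉0 : IsOddPrimePower q → ¬ 1# + 1# ≈ 0#
  oddPrimePower⇒1+1≉0 ((p , k , _ , 0<k , q≡pᵏ) , 2∤q) = odd-char⇒1+1≉0 2∤p (q≡pᵏ⇒p×1≈0 {p} {k} q≡pᵏ)
    where
    2∤p : ¬ 2 ∣ p
    2∤p 2∣p = 2∤q (≡.subst (2 ∣_) (≡.sym q≡pᵏ) (∣⇒∣^ 2∣p 0<k))

  module QuarticExtension (α : Carrier) (α-primitive : IsPrimitive F α) (1<q : 1 ℕ.< q)
                          (^q-+ : ∀ a b → (a + b) ^ q ≈ a ^ q + b ^ q) (x : ℕ) where
    open import Relation.Binary.Reasoning.Setoid setoid

    φ : Carrier → Carrier
    φ a = a ^ q

    φ-cong : ∀ {a b} → a ≈ b → φ a ≈ φ b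
    φ-cong = ^-congˡ q

    φ-* : ∀ a b → φ (a * b) ≈ φ a * φ b
    φ-* a b = ^-distrib-* a b q

    open Trace F φ φ-cong ^q-+ φ-* public

    Q : ℕ
    Q = q ℕ.^ 2

    y ζ η : Carrier
    y = α ^ x
    ζ = α ^ (q ℕ.+ 1)
    η = ζ ^ suc Q

    instance
      q⁴≢0 : NonZero (q ℕ.^ 4)
      q⁴≢0 = ℕ.>-nonZero (ℕ.<-trans ℕ.z<s (ℕ.^-monoʳ-< q 1<q {0} {4} ℕ.z<s))
      q⁴∸1≢0 : NonZero (q ℕ.^ 4 ℕ.∸ 1)
      q⁴∸1≢0 = ℕ.>-nonZero (ℕ.m<n⇒0<n∸m (ℕ.^-monoʳ-< q 1<q {0} {4} ℕ.z<s))

    α^[q⁴∸1]≈1 : α ^ (q ℕ.^ 4 ℕ.∸ 1) ≈ 1#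
    α^[q⁴∸1]≈1 = ≡.subst (_≈ 1#) (pow≡^ α (q ℕ.^ 4 ℕ.∸ 1)) (proj₁ α-primitive)

    α≉0 : ¬ α ≈ 0#
    α≉0 α≈0 = 0≉1 (begin
      0#                          ≈⟨ zeroˡ _ ⟨
      0# * α ^ ℕ.pred M           ≈⟨ *-congʳ α≈0 ⟨
      α ^ suc (ℕ.pred M)          ≡⟨ ≡.cong (α ^_) (ℕ.suc-pred (q ℕ.^ 4 ℕ.∸ 1)) ⟩
      α ^ M                       ≈⟨ α^[q⁴∸1]≈1 ⟩
      1#                          ∎)
      where
      M : ℕ
      M = q ℕ.^ 4 ℕ.∸ 1

    α^q⁴≈α : α ^ (q ℕ.^ 4) ≈ α
    α^q⁴≈α = begin
      α ^ (q ℕ.^ 4)                  ≡⟨ ≡.cong (α ^_) (ℕ.suc-pred (q ℕ.^ 4)) ⟨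
      α * α ^ (q ℕ.^ 4 ℕ.∸ 1)        ≈⟨ *-congˡ α^[q⁴∸1]≈1 ⟩
      α * 1#                         ≈⟨ *-identityʳ α ⟩
      α                              ∎

    ^q^[1+n]≈φ[^q^n] : ∀ n a → a ^ (q ℕ.^ suc n) ≈ φ (a ^ (q ℕ.^ n))
    ^q^[1+n]≈φ[^q^n] n a = begin
      a ^ (q ℕ.* q ℕ.^ n)       ≡⟨ ≡.cong (a ^_) (ℕ.*-comm q (q ℕ.^ n)) ⟩
      a ^ (q ℕ.^ n ℕ.* q)       ≈⟨ ^-assocʳ a (q ℕ.^ n) q ⟨
      φ (a ^ (q ℕ.^ n))         ∎

    ^Q≈σ : ∀ a → a ^ Q ≈ σ a
    ^Q≈σ a = trans (^q^[1+n]≈φ[^q^n] 1 a) (φ-cong (trans (^q^[1+n]≈φ[^q^n] 0 a) (φ-cong (*-identityʳ a))))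

    Tr≈trace : ∀ a → Tr F q a ≈ trace a
    Tr≈trace a = +-cong (+-cong (+-congˡ (reflexive (pow≡^ a q))) (trans (reflexive (pow≡^ a Q)) (^Q≈σ a)))
                        (trans (reflexive (pow≡^ a (q ℕ.^ 3))) (trans (^q^[1+n]≈φ[^q^n] 2 a) (φ-cong (^Q≈σ a))))

    σσ-α^ : ∀ m → σ (σ (α ^ m)) ≈ α ^ m
    σσ-α^ m = begin
      σ (σ (α ^ m))            ≈⟨ φ-cong (φ-cong (^Q≈σ (α ^ m))) ⟨
      φ (φ ((α ^ m) ^ Q))      ≈⟨ φ-cong (^q^[1+n]≈φ[^q^n] 2 (α ^ m)) ⟨
      φ ((α ^ m) ^ (q ℕ.^ 3))  ≈⟨ ^q^[1+n]≈φ[^q^n] 3 (α ^ m) ⟨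
      (α ^ m) ^ (q ℕ.^ 4)      ≈⟨ ^-comm α m (q ℕ.^ 4) ⟩
      (α ^ (q ℕ.^ 4)) ^ m      ≈⟨ ^-congˡ m α^q⁴≈α ⟩
      α ^ m                    ∎

    σσy≈y : σ (σ y) ≈ y
    σσy≈y = σσ-α^ x

    σσ-ζ^ : ∀ i → σ (σ (ζ ^ i)) ≈ ζ ^ i
    σσ-ζ^ i = trans (σ-cong (σ-cong (^-assocʳ α (q ℕ.+ 1) i))) (trans (σσ-α^ ((q ℕ.+ 1) ℕ.* i)) (sym (^-assocʳ α (q ℕ.+ 1) i)))

    φη≈η : φ η ≈ η
    φη≈η = begin
      φ η          ≈⟨ φ-cong η≈α^A ⟩
      φ (α ^ A)    ≈⟨ *-cancelˡ-≉0 α≉0 α*φ[α^A]≈α*α^A ⟩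
      α ^ A        ≈⟨ η≈α^A ⟨
      η            ∎
      where
      A : ℕ
      A = (q ℕ.+ 1) ℕ.* suc Q
      η≈α^A : η ≈ α ^ A
      η≈α^A = ^-assocʳ α (q ℕ.+ 1) (suc Q)
      α*φ[α^A]≈α*α^A : α * φ (α ^ A) ≈ α * α ^ A
      α*φ[α^A]≈α*α^A = begin
        α * (α ^ A) ^ q            ≈⟨ *-congˡ (^-assocʳ α A q) ⟩
        α ^ suc (A ℕ.* q)          ≡⟨ ≡.cong (α ^_) (1+[q+1][1+q²]q≡[q+1][1+q²]+q⁴ q) ⟩
        α ^ (A ℕ.+ q ℕ.^ 4)        ≈⟨ ^-homo-* α A (q ℕ.^ 4) ⟩
        α ^ A * α ^ (q ℕ.^ 4)      ≈⟨ *-congˡ α^q⁴≈α ⟩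
        α ^ A * α                  ≈⟨ *-comm (α ^ A) α ⟩
        α * α ^ A                  ∎

    φ-η^ : ∀ k → φ (η ^ k) ≈ η ^ k
    φ-η^ k = trans (^-comm η k q) (^-congˡ k φη≈η)

    η^≉0 : ∀ k → ¬ η ^ k ≈ 0#
    η^≉0 k = x≉0⇒x^n≉0 k (x≉0⇒x^n≉0 (suc Q) (x≉0⇒x^n≉0 (q ℕ.+ 1) α≉0))

    ζ^*σζ^≈η^ : ∀ i → ζ ^ i * σ (ζ ^ i) ≈ η ^ i
    ζ^*σζ^≈η^ i = trans (*-congˡ (sym (^Q≈σ (ζ ^ i)))) (^-comm ζ i (suc Q))

    φ-fixes-ζ^*σζ^ : ∀ i → φ (ζ ^ i * σ (ζ ^ i)) ≈ ζ ^ i * σ (ζ ^ i)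
    φ-fixes-ζ^*σζ^ i = trans (φ-cong (ζ^*σζ^≈η^ i)) (trans (φ-η^ i) (sym (ζ^*σζ^≈η^ i)))

    σζ^[1+k]≈η^k*ζ^negMod : ∀ {k} → k ℕ.≤ Q → σ (ζ ^ suc k) ≈ η ^ k * ζ ^ negMod q (suc k)
    σζ^[1+k]≈η^k*ζ^negMod {k} k≤Q = begin
      σ (ζ ^ suc k)                        ≈⟨ ^Q≈σ (ζ ^ suc k) ⟨
      (ζ ^ suc k) ^ Q                      ≈⟨ ^-assocʳ ζ (suc k) Q ⟩
      ζ ^ (suc k ℕ.* Q)                    ≡⟨ ≡.cong (ζ ^_) ([1+k]Q≡[Q∸k]+[1+Q]k k≤Q) ⟩
      ζ ^ (Q ℕ.∸ k ℕ.+ suc Q ℕ.* k)        ≈⟨ ^-homo-* ζ (Q ℕ.∸ k) (suc Q ℕ.* k) ⟩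
      ζ ^ (Q ℕ.∸ k) * ζ ^ (suc Q ℕ.* k)    ≈⟨ *-congˡ (^-assocʳ ζ (suc Q) k) ⟨
      ζ ^ (Q ℕ.∸ k) * η ^ k                ≈⟨ *-comm _ _ ⟩
      η ^ k * ζ ^ (Q ℕ.∸ k)                ≡⟨ ≡.cong (λ e → η ^ k * ζ ^ e) (negMod-suc q k) ⟨
      η ^ k * ζ ^ negMod q (suc k)         ∎

    σ-fixes-ζ^⇒q²+1∣[q+1]i : ∀ i → σ (ζ ^ i) ≈ ζ ^ i → q ℕ.^ 2 ℕ.+ 1 ∣ (q ℕ.+ 1) ℕ.* i
    σ-fixes-ζ^⇒q²+1∣[q+1]i i σu≈u =
      [q⁴∸1]∣e[q²∸1]⇒[q²+1]∣e 1<q (primitive⇒order∣ α-primitive (*-cancelˡ-≉0 (x≉0⇒x^n≉0 e α≉0) (begin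
        α ^ e * α ^ (e ℕ.* K)       ≈⟨ ^-homo-* α e (e ℕ.* K) ⟨
        α ^ (e ℕ.+ e ℕ.* K)         ≡⟨ ≡.cong (α ^_) (ℕ.*-suc e K) ⟨
        α ^ (e ℕ.* suc K)           ≡⟨ ≡.cong (λ n → α ^ (e ℕ.* n)) (ℕ.suc-pred Q) ⟩
        α ^ (e ℕ.* Q)               ≈⟨ ^-assocʳ α e Q ⟨
        (α ^ e) ^ Q                 ≈⟨ ^-congˡ Q ζ^i≈α^e ⟨
        (ζ ^ i) ^ Q                 ≈⟨ ^Q≈σ (ζ ^ i) ⟩
        σ (ζ ^ i)                   ≈⟨ σu≈u ⟩
        ζ ^ i                       ≈⟨ ζ^i≈α^e ⟩
        α ^ e                       ≈⟨ *-identityʳ (α ^ e) ⟨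
        α ^ e * 1#                  ∎)))
      where
      e K : ℕ
      e = (q ℕ.+ 1) ℕ.* i
      K = Q ℕ.∸ 1
      instance
        Q≢0 : NonZero Q
        Q≢0 = ℕ.m^n≢0 q 2 {{ℕ.>-nonZero (ℕ.<-trans ℕ.z<s 1<q)}}
      ζ^i≈α^e : ζ ^ i ≈ α ^ e
      ζ^i≈α^e = ^-assocʳ α (q ℕ.+ 1) i

    Tr≈trace[y*ζ^j] : ∀ j → Tr F q (pow F α (x ℕ.+ (q ℕ.+ 1) ℕ.* j)) ≈ trace (y * ζ ^ j)
    Tr≈trace[y*ζ^j] j = trans (Tr≈trace _) (trace-cong (begin
      pow F α (x ℕ.+ (q ℕ.+ 1) ℕ.* j)    ≡⟨ pow≡^ α (x ℕ.+ (q ℕ.+ 1) ℕ.* j) ⟩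
      α ^ (x ℕ.+ (q ℕ.+ 1) ℕ.* j)        ≈⟨ ^-homo-* α x ((q ℕ.+ 1) ℕ.* j) ⟩
      y * α ^ ((q ℕ.+ 1) ℕ.* j)          ≈⟨ *-congˡ (^-assocʳ α (q ℕ.+ 1) j) ⟨
      y * ζ ^ j                      ∎))

    InC⇒trace≈0 : ∀ {j} → InC F q α x j → trace (y * ζ ^ j) ≈ 0#
    InC⇒trace≈0 {j} (_ , Tr≈0) = trans (sym (Tr≈trace[y*ζ^j] j)) Tr≈0

    trace[y*σζ^[1+k]] : ∀ {k} → k ℕ.≤ Q → trace (y * σ (ζ ^ suc k)) ≈ η ^ k * trace (y * ζ ^ negMod q (suc k))
    trace[y*σζ^[1+k]] {k} k≤Q = begin
      trace (y * σ (ζ ^ suc k))                 ≈⟨ trace-cong (*-congˡ (σζ^[1+k]≈η^k*ζ^negMod k≤Q)) ⟩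
      trace (y * (η ^ k * ζ ^ negMod q (suc k))) ≈⟨ trace-cong (x∙yz≈y∙xz (y) (η ^ k) _) ⟩
      trace (η ^ k * (y * ζ ^ negMod q (suc k))) ≈⟨ trace-*-φ-fixed (φ-η^ k) _ ⟩
      η ^ k * trace (y * ζ ^ negMod q (suc k))   ∎
      where open import Algebra.Properties.CommutativeSemigroup *-commutativeSemigroup using (x∙yz≈y∙xz)

    negMod∈C⇒trace[y*σζ^[1+k]]≈0 : ∀ {k} → k ℕ.≤ Q → InC F q α x (negMod q (suc k)) → trace (y * σ (ζ ^ suc k)) ≈ 0#
    negMod∈C⇒trace[y*σζ^[1+k]]≈0 k≤Q -j∈C = trans (trace[y*σζ^[1+k]] k≤Q) (trans (*-congˡ (InC⇒trace≈0 -j∈C)) (zeroʳ _))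

    InC-suc⇒≤Q : ∀ {k} → InC F q α x (suc k) → k ℕ.≤ Q
    InC-suc⇒≤Q (1+k<Q+1 , _) = ℕ.<⇒≤ (1+m<n+1⇒m<n 1+k<Q+1)

    trace[y*σζ^[1+k]]≈0⇒negMod∈C : ∀ {k} → k ℕ.≤ Q → trace (y * σ (ζ ^ suc k)) ≈ 0# → InC F q α x (negMod q (suc k))
    trace[y*σζ^[1+k]]≈0⇒negMod∈C {k} k≤Q trace≈0 = negMod< q (suc k) , trans (Tr≈trace[y*ζ^j] _) trace[y*ζ^negMod]≈0
      where
      trace[y*ζ^negMod]≈0 : trace (y * ζ ^ negMod q (suc k)) ≈ 0#
      trace[y*ζ^negMod]≈0 = *-cancelˡ-≉0 (η^≉0 k) (trans (sym (trace[y*σζ^[1+k]] k≤Q)) (trans trace≈0 (sym (zeroʳ _))))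

    σ-negates-y : ¬ 1# + 1# ≈ 0# → ¬ 2 ∣ q → ∀ {i} → InC F q α x 0 → InC F q α x (suc i) →
                  InC F q α x (negMod q (suc i)) → ¬ suc i ≡ half q → σ y ≈ - y
    σ-negates-y 2≉0 2∤q {i} 0∈C i∈C -i∈C i≢half
      with σ-negates⊎σ-fixes 2≉0 σσy≈y (σσ-ζ^ (suc i)) (φ-fixes-ζ^*σζ^ (suc i)) trace-y≈0
             (InC⇒trace≈0 i∈C) (negMod∈C⇒trace[y*σζ^[1+k]]≈0 (InC-suc⇒≤Q i∈C) -i∈C)
      where
      trace-y≈0 : trace y ≈ 0#
      trace-y≈0 = trans (trace-cong (sym (*-identityʳ y))) (InC⇒trace≈0 0∈C)
    ... | inj₁ σy≈-y     = σy≈-y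
    ... | inj₂ σζ^i≈ζ^i = contradiction
      (q²+1∣[q+1]i⇒i≡half 2∤q (σ-fixes-ζ^⇒q²+1∣[q+1]i (suc i) σζ^i≈ζ^i) ℕ.z<s (proj₁ i∈C)) i≢half

    σ-negates-y⇒negMod∈C : σ y ≈ - y → ∀ {j} → InC F q α x (suc j) → InC F q α x (negMod q (suc j))
    σ-negates-y⇒negMod∈C σy≈-y {j} j∈C = trace[y*σζ^[1+k]]≈0⇒negMod∈C (InC-suc⇒≤Q j∈C)
      (σ-negates⇒trace-σ≈0 σy≈-y (σσ-ζ^ (suc j)) (InC⇒trace≈0 j∈C))

open import Data.Nat using (_^_)

mainTheorem13 : {c ℓ : Level} (q : ℕ) → IsOddPrimePower q →
    (F : FiniteField c ℓ (q ^ 4)) (α : FiniteField.Carrier F) → IsPrimitive F α →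
    (x : ℕ) → InD F q α x →
    (i j : ℕ) →
    InC F q α x 0 → InC F q α x i → InC F q α x (negMod q i) → InC F q α x j →
    ¬ (i ≡ 0) → ¬ (i ≡ half q) → ¬ (j ≡ 0) → ¬ (j ≡ half q) →
    InC F q α x (negMod q j)
mainTheorem13 _ _ _ _ _ _ _ zero    _       _ _ _ _ i≢0 _ _   _ = contradiction ≡.refl i≢0
mainTheorem13 _ _ _ _ _ _ _ (suc _) zero    _ _ _ _ _   _ j≢0 _ = contradiction ≡.refl j≢0
mainTheorem13 q q-odd-prime-power F α α-primitive x _ (suc i) (suc j) 0∈C i∈C -i∈C j∈C _ i≢half _ _ =
  σ-negates-y⇒negMod∈C σy≈-y j∈C
  where
  open FiniteField F using (_≈_; -_)
  open QuarticExtension q F α α-primitive (Arithmetic.oddPrimePower⇒1< q-odd-prime-power)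
                        (oddPrimePower⇒^q-+ q F q-odd-prime-power) x
  σy≈-y : σ y ≈ - y
  σy≈-y = σ-negates-y (oddPrimePower⇒1+1≉0 q F q-odd-prime-power) (proj₂ q-odd-prime-power) 0∈C i∈C -i∈C i≢half
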